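{- Let $\mathcal{S}$ be a compact surface without boundary (orientable or not) and let $(\mathfrak{u},\mathfrak{l})$ be a labeled unicellular mobile on $\mathcal{S}$. Consider the cyclic sequence of corners of $\mathfrak{u}$ incident to white vertices, ordered around the unique face of $\mathfrak{u}$ in the orientation given by its root; the label of a corner is the label of its vertex. Then: (i) If $A$ and $B$ are two distinct nontrivial arcs whose intersection contains internal corners of $A$ or of $B$, then $A\subseteq B$ or $B\subseteq A$, and the level of the larger arc is strictly lower than the level of the smaller arc. (ii) The following three properties are equivalent: (a) for all $i\ge 1$, every nontrivial arc of level $i$ contains a corner with label $i+1$; (b) for all $i\ge 1$, every nontrivial arc of level $i$ has set of internal corner labels of the form $\{i+1,i+2,\dots,m\}$ for some $m$; (c) for all $i\ge 2$ and every corner with label $i$, either the first subsequent corner with label strictly smaller than $i$ has label $i-1$, or the last preceding corner with label strictly smaller than $i$ has label $i-1$. (iii) If the equivalent properties of (ii) hold, then for all $i\ge 2$, every arc of level $i$ is contained in a unique arc of level $i-1$, and this arc is nontrivial; similarly, every corner with label $i\ge 2$ is contained in a unique arc of level $i-1$, and this arc is nontrivial.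
   Context: A map on $\mathcal{S}$ is a cellular embedding of a finite connected graph (loops and multiple edges allowed) into $\mathcal{S}$, up to homeomorphism; its faces are homeomorphic to open disks. A corner is an angular sector between two consecutive half-edges around a vertex inside a face. A rooted map has a distinguished oriented corner (the root); its vertex is the root vertex. A labeled unicellular mobile is a pair $(\mathfrak{u},\mathfrak{l})$ where $\mathfrak{u}$ is a rooted map of $\mathcal{S}$ with exactly one face, whose vertex set is partitioned into green vertices $V_\bullet(\mathfrak{u})$ and white vertices $V_\circ(\mathfrak{u})$ so that every edge joins a green vertex to a white vertex, whose root vertex is white, and $\mathfrak{l}:V_\circ(\mathfrak{u})\to\{1,2,3,\dots\}$ is a function with minimum $1$. Since the face is a disk, the root orients it and the corners incident to white vertices are cyclically ordered around the face; only these corners are considered. An arc is a contiguous interval (in this cyclic order) of two or more consecutive corners such that its first and last corners (its extremities) have labels strictly smaller than the labels of all its other corners (its internal corners). If the extremities have labels $i$ and $j$, the arc is an $\{i,j\}$-arc and its level is $\max(i,j)$. An arc is trivial if it contains exactly two corners. -}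

module Defs where

open import Data.Nat using (ℕ; zero; suc; _+_; _*_; _∸_; _≤_; _<_; _⊔_)
open import Data.Nat.DivMod using (_mod_)
open import Data.Fin using (Fin; toℕ)
open import Data.Product using (Σ; ∃; _×_; _,_)
open import Data.Sum using (_⊎_)
open import Relation.Binary.PropositionalEquality using (_≡_; _≢_)
open import Function.Definitions using (Surjective)

-- The combinatorial data of a labeled unicellular mobile that the statement
-- refers to: the cyclic sequence of the N = suc n corners incident to white
-- vertices (indexed 0..n in the order around the face given by the root,
-- starting anywhere), the white vertex of each such corner, and the labeling
-- of white vertices (positive, with minimum 1).
record LabeledWhiteCorners : Set where
  field
    n      : ℕ                          -- number of white corners is suc n
    V      : ℕ
    vertex : Fin (suc n) → Fin V
    vertex-surj : Surjective _≡_ _≡_ vertex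
    lbl    : Fin V → ℕ
    lbl-pos : ∀ v → 1 ≤ lbl v
    lbl-min : ∃ λ v → lbl v ≡ 1

module Corners (n : ℕ) (lab : Fin (suc n) → ℕ) where

  N : ℕ
  N = suc n

  fwd : Fin N → ℕ → Fin N
  fwd c k = (toℕ c + k) mod N

  -- the corner reached from corner c after k steps backward
  -- ((N - 1) * k ≡ - k modulo N)
  bwd : Fin N → ℕ → Fin N
  bwd c k = (toℕ c + n * k) mod N

  -- An interval of consecutive corners: first corner s and length L;
  -- its corners are fwd s 0, …, fwd s (L ∸ 1).
  Interval : Set
  Interval = Fin N × ℕ

  first last : Interval → Fin N
  first (s , L) = s
  last  (s , L) = fwd s (L ∸ 1)

  _∈I_ : Fin N → Interval → Set
  c ∈I (s , L) = Σ ℕ λ k → k < L × fwd s k ≡ c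

  Internal : Fin N → Interval → Set
  Internal c (s , L) = Σ ℕ λ k → 0 < k × suc k < L × fwd s k ≡ c

  -- An arc: two or more consecutive corners (at most once around, the first
  -- and last corner possibly being the same corner when going once around),
  -- whose extremities have labels strictly smaller than those of all internal corners.
  IsArc : Interval → Set
  IsArc (s , L) = 2 ≤ L × L ≤ suc N ×
    (∀ k → 0 < k → suc k < L →
       lab s < lab (fwd s k) × lab (fwd s (L ∸ 1)) < lab (fwd s k))

  Arc : Set
  Arc = Σ Interval IsArc

  interval : Arc → Interval
  interval (I , _) = I

  level : Arc → ℕ
  level ((s , L) , _) = lab s ⊔ lab (fwd s (L ∸ 1))

  Trivial : Arc → Set
  Trivial ((s , L) , _) = L ≡ 2

  NonTrivial : Arc → Set
  NonTrivial ((s , L) , _) = 2 < L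

  _⊆I_ : Interval → Interval → Set
  (s , L) ⊆I (s' , L') = Σ ℕ λ d → d + L ≤ L' × fwd s' d ≡ s

  _⊆A_ : Arc → Arc → Set
  A ⊆A B = interval A ⊆I interval B

  _∈A_ : Fin N → Arc → Set
  c ∈A A = c ∈I interval A

  PropA : Set
  PropA = ∀ i → 1 ≤ i → (A : Arc) → level A ≡ i → NonTrivial A →
          Σ (Fin N) λ c → c ∈A A × lab c ≡ suc i

  PropB : Set
  PropB = ∀ i → 1 ≤ i → (A : Arc) → level A ≡ i → NonTrivial A →
          Σ ℕ λ m → ∀ x →
            ((Σ (Fin N) λ c → Internal c (interval A) × lab c ≡ x) → suc i ≤ x × x ≤ m) ×
            (suc i ≤ x → x ≤ m → Σ (Fin N) λ c → Internal c (interval A) × lab c ≡ x)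

  NextSmallerIsPred : Fin N → Set
  NextSmallerIsPred c = Σ ℕ λ k → 0 < k × lab (fwd c k) ≡ lab c ∸ 1 ×
    (∀ j → 0 < j → j < k → lab c ≤ lab (fwd c j))

  PrevSmallerIsPred : Fin N → Set
  PrevSmallerIsPred c = Σ ℕ λ k → 0 < k × lab (bwd c k) ≡ lab c ∸ 1 ×
    (∀ j → 0 < j → j < k → lab c ≤ lab (bwd c j))

  PropC : Set
  PropC = ∀ i → 2 ≤ i → (c : Fin N) → lab c ≡ i →
          NextSmallerIsPred c ⊎ PrevSmallerIsPred c

cornerLabel : (M : LabeledWhiteCorners) → Fin (suc (LabeledWhiteCorners.n M)) → ℕ
cornerLabel M c = LabeledWhiteCorners.lbl M (LabeledWhiteCorners.vertex M c)

module Submission where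

-- Unroll the cyclic sequence of corners into an N-periodic sequence of labels on ℕ. Two arcs sharing
-- a corner that is internal to one of them then become intervals of ℕ of which one has an extremity
-- strictly inside the other (crossing is impossible, as each crossing extremity would have to exceed
-- the other), and an extremity inside an arc exceeds its level: this is (i).
-- For a corner c with label at least 2, its window, from the last preceding to the first following
-- corner of smaller label, is a nontrivial arc having c as an internal corner and level below lab c.
-- Property (a) forces the level of every window to be exactly lab c − 1, which is (c), and together
-- with (i) it makes the window the unique arc of that level around c and around any arc having c as
-- an extremity, which is (iii). Conversely (c) gives (b) by descending from the largest internal
-- label of an arc one unit at a time, the walk prescribed by (c) never leaving the arc because the
-- labels it crosses exceed the level.

open import Defs
open import Data.Empty using (⊥; ⊥-elim)
open import Data.Fin using (Fin; toℕ)
open import Data.Fin.Properties using (toℕ-injective; toℕ-fromℕ<; toℕ<n)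
import Data.Fin.Properties as Fin
open import Data.Nat
  using (ℕ; zero; suc; _+_; _*_; _∸_; _⊔_; _≤_; _<_; z≤n; s≤s; s≤s⁻¹; z<s; NonZero; _≤?_; _<?_; <-cmp)
open import Data.Nat.DivMod using (_mod_; _%_; _/_; m≡m%n+[m/n]*n; [m+kn]%n≡m%n; m%n<n; m<n⇒m%n≡m)
open import Data.Nat.Properties
import Data.Nat.Properties as ℕ
open import Algebra.Properties.CommutativeSemigroup +-commutativeSemigroup using (xy∙z≈xz∙y)
open import Data.Nat.Tactic.RingSolver using (solve-∀)
open import Data.Product using (Σ; _×_; _,_; proj₁; proj₂)
open import Data.Product.Properties using (≡-dec)
open import Data.Sum using (_⊎_; inj₁; inj₂; [_,_]′; swap)
import Data.Sum as Sum
open import Function using (_∘_)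
open import Function.Bundles using (_⇔_; mk⇔)
open import Relation.Binary.Definitions using (tri<; tri≈; tri>)
open import Relation.Binary.PropositionalEquality
  using (_≡_; _≢_; refl; sym; trans; cong; cong₂; subst; subst₂; module ≡-Reasoning)
open import Relation.Nullary using (¬_; Dec; yes; no; contradiction)
open import Relation.Unary using (Decidable)

least : {P : ℕ → Set} → Decidable P → ∀ {k} → P k →
        Σ ℕ λ m → m ≤ k × P m × (∀ {j} → j < m → ¬ P j)
least P? {k} pk with P? 0
... | yes p0 = 0 , z≤n , p0 , λ ()
least P? {zero} p0 | no ¬p0 = contradiction p0 ¬p0
least {P} P? {suc k} pk | no ¬p0 with least {λ j → P (suc j)} (P? ∘ suc) pk
... | m , m≤k , pm , below =
  suc m , s≤s m≤k , pm , λ { {zero} _ → ¬p0 ; {suc j} j<m → below (s≤s⁻¹ j<m) }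

record FirstBelow (g : ℕ → ℕ) (h k : ℕ) : Set where
  field
    positive : 0 < k
    drops : g k < h
    before : ∀ j → 0 < j → j < k → h ≤ g j

first-below : (g : ℕ → ℕ) {h k : ℕ} → h ≤ g 0 → g k < h → Σ ℕ λ m → m ≤ k × FirstBelow g h m
first-below g {h} h≤g0 gk<h with least (λ j → g j <? h) gk<h
... | zero , _ , g0<h , _ = ⊥-elim (<⇒≱ g0<h h≤g0)
... | suc m , m≤k , gm<h , below =
  suc m , m≤k , record { positive = z<s ; drops = gm<h ; before = λ j _ j<m → ≮⇒≥ (below j<m) }

pred≤-up-to-drop : {g : ℕ → ℕ} {h k : ℕ} → g k ≡ h ∸ 1 → (∀ j → 0 < j → j < k → h ≤ g j) →
                   ∀ j → 0 < j → j ≤ k → h ∸ 1 ≤ g j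
pred≤-up-to-drop {h = h} drop before j 0<j j≤k with m≤n⇒m<n∨m≡n j≤k
... | inj₁ j<k = ≤-trans (m∸n≤m h 1) (before j 0<j j<k)
... | inj₂ refl = ≤-reflexive (sym drop)

maxOver : (ℕ → ℕ) → ℕ → ℕ
maxOver g zero = 0
maxOver g (suc K) = maxOver g K ⊔ g (suc K)

≤-maxOver : (g : ℕ → ℕ) {k K : ℕ} → 0 < k → k ≤ K → g k ≤ maxOver g K
≤-maxOver g {k} {suc K} 0<k k≤K with m≤n⇒m<n∨m≡n k≤K
... | inj₁ k<K = ≤-trans (≤-maxOver g 0<k (s≤s⁻¹ k<K)) (m≤m⊔n _ _)
... | inj₂ refl = m≤n⊔m _ _
≤-maxOver g {suc k} {zero} _ ()

maxOver-attained : (g : ℕ → ℕ) (K : ℕ) → 0 < K → Σ ℕ λ k → 0 < k × k ≤ K × g k ≡ maxOver g K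
maxOver-attained g (suc zero) _ = 1 , z<s , ≤-refl , refl
maxOver-attained g (suc (suc K)) _
  with maxOver-attained g (suc K) z<s | ⊔-sel (maxOver g (suc K)) (g (suc (suc K)))
... | k , 0<k , k≤K , gk | inj₁ eq = k , 0<k , m≤n⇒m≤1+n k≤K , trans gk (sym eq)
... | _ | inj₂ eq = suc (suc K) , z<s , ≤-refl , sym eq

module _ {N : ℕ} .{{_ : NonZero N}} where

  toℕ-mod : ∀ x → toℕ (x mod N) ≡ x % N
  toℕ-mod x = toℕ-fromℕ< (m%n<n x N)

  mod-congruent : ∀ x y a b → x + a * N ≡ y + b * N → x mod N ≡ y mod N
  mod-congruent x y a b eq = toℕ-injective (begin
    toℕ (x mod N)    ≡⟨ toℕ-mod x ⟩
    x % N            ≡⟨ [m+kn]%n≡m%n x a N ⟨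
    (x + a * N) % N  ≡⟨ cong (_% N) eq ⟩
    (y + b * N) % N  ≡⟨ [m+kn]%n≡m%n y b N ⟩
    y % N            ≡⟨ toℕ-mod y ⟨
    toℕ (y mod N)    ∎)
    where open ≡-Reasoning

  mod-toℕ : (s : Fin N) → toℕ s mod N ≡ s
  mod-toℕ s = toℕ-injective (trans (toℕ-mod (toℕ s)) (m<n⇒m%n≡m (toℕ<n s)))

  mod-+ : ∀ x y → (toℕ (x mod N) + y) mod N ≡ (x + y) mod N
  mod-+ x y = mod-congruent _ _ (x / N) 0 (begin
    toℕ (x mod N) + y + x / N * N  ≡⟨ cong (λ r → r + y + x / N * N) (toℕ-mod x) ⟩
    x % N + y + x / N * N          ≡⟨ xy∙z≈xz∙y (x % N) y (x / N * N) ⟩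
    x % N + x / N * N + y          ≡⟨ cong (_+ y) (m≡m%n+[m/n]*n x N) ⟨
    x + y                          ≡⟨ +-identityʳ (x + y) ⟨
    x + y + 0 * N                  ∎)
    where open ≡-Reasoning

module Linear (F : ℕ → ℕ) where

  Between StrictlyBetween : ℕ × ℕ → ℕ → Set
  Between (a , z) x = a ≤ x × x ≤ z
  StrictlyBetween (a , z) x = a < x × x < z

  IsArc : ℕ × ℕ → Set
  IsArc (a , z) = a < z × (∀ {x} → a < x → x < z → F a < F x × F z < F x)

  level : ℕ × ℕ → ℕ
  level (a , z) = F a ⊔ F z

  Nested : ℕ × ℕ → ℕ × ℕ → Set
  Nested (a , z) (b , w) = (b ≤ a × z ≤ w) × level (b , w) < level (a , z)

  level<inner : ∀ {a z x} → IsArc (a , z) → a < x → x < z → level (a , z) < F x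
  level<inner (_ , inner) a<x x<z = ⊔-pres-<m (proj₁ (inner a<x x<z)) (proj₂ (inner a<x x<z))

  nested-same-start : ∀ {a z w} → IsArc (a , z) → IsArc (a , w) → z < w → Nested (a , z) (a , w)
  nested-same-start A B z<w =
    (≤-refl , <⇒≤ z<w) , <-≤-trans (level<inner B (proj₁ A) z<w) (m≤n⊔m _ _)

  nested-later-start : ∀ {a z b w x} → a < b → IsArc (a , z) → IsArc (b , w) → x ≤ z → b ≤ x →
                       StrictlyBetween (a , z) x ⊎ StrictlyBetween (b , w) x → Nested (b , w) (a , z)
  nested-later-start {a} {z} {b} {w} {x} a<b A B x≤z b≤x inner with w ≤? z | b <? z
  ... | yes w≤z | _ =
    (<⇒≤ a<b , w≤z) , <-≤-trans (level<inner A a<b (<-≤-trans (proj₁ B) w≤z)) (m≤m⊔n (F b) (F w))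
  ... | no w≰z | yes b<z =
    ⊥-elim (<-asym (proj₂ (proj₂ A a<b b<z)) (proj₁ (proj₂ B b<z (≰⇒> w≰z))))
  ... | no _ | no b≮z = ⊥-elim (touching inner)
    where
    z≤b : z ≤ b
    z≤b = ≮⇒≥ b≮z
    touching : StrictlyBetween (a , z) x ⊎ StrictlyBetween (b , w) x → ⊥
    touching (inj₁ (_ , x<z)) = <-irrefl refl (<-≤-trans x<z (≤-trans z≤b b≤x))
    touching (inj₂ (b<x , _)) = <-irrefl refl (<-≤-trans b<x (≤-trans x≤z z≤b))

  nested : ∀ {I J x} → IsArc I → IsArc J → I ≢ J → Between I x → Between J x →
           StrictlyBetween I x ⊎ StrictlyBetween J x → Nested I J ⊎ Nested J I
  nested {a , z} {b , w} A B I≢J (a≤x , x≤z) (b≤x , x≤w) inner with <-cmp a b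
  ... | tri< a<b _ _ = inj₂ (nested-later-start a<b A B x≤z b≤x inner)
  ... | tri> _ _ b<a = inj₁ (nested-later-start b<a B A x≤w a≤x (swap inner))
  ... | tri≈ _ refl _ with <-cmp z w
  ...   | tri< z<w _ _ = inj₁ (nested-same-start A B z<w)
  ...   | tri≈ _ refl _ = ⊥-elim (I≢J refl)
  ...   | tri> _ _ w<z = inj₂ (nested-same-start B A w<z)

module Cyclic {n : ℕ} (lab : Fin (suc n) → ℕ) where
  open Corners n lab

  fwd-0 : ∀ s → fwd s 0 ≡ s
  fwd-0 s = trans (cong (_mod N) (+-identityʳ (toℕ s))) (mod-toℕ s)

  bwd-0 : ∀ c → bwd c 0 ≡ c
  bwd-0 c = trans (cong (λ m → (toℕ c + m) mod N) (*-zeroʳ n)) (fwd-0 c)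

  fwd-fwd : ∀ s j k → fwd (fwd s j) k ≡ fwd s (j + k)
  fwd-fwd s j k = trans (mod-+ (toℕ s + j) k) (cong (_mod N) (+-assoc (toℕ s) j k))

  fwd-bwd : ∀ c j k → fwd (bwd c (j + k)) k ≡ bwd c j
  fwd-bwd c j k =
    trans (mod-+ (toℕ c + n * (j + k)) k) (mod-congruent _ _ 0 k (identity (toℕ c) n j k))
    where
    identity : ∀ c n j k → c + n * (j + k) + k + 0 * suc n ≡ c + n * j + k * suc n
    identity = solve-∀

  fwd-bwd-past : ∀ c k j → fwd (bwd c k) (k + j) ≡ fwd c j
  fwd-bwd-past c k j =
    trans (mod-+ (toℕ c + n * k) (k + j)) (mod-congruent _ _ 0 k (identity (toℕ c) n k j))
    where
    identity : ∀ c n k j → c + n * k + (k + j) + 0 * suc n ≡ c + j + k * suc n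
    identity = solve-∀

  bwd-fwd : ∀ s j k → bwd (fwd s (j + k)) j ≡ fwd s k
  bwd-fwd s j k =
    trans (mod-+ (toℕ s + (j + k)) (n * j)) (mod-congruent _ _ 0 j (identity (toℕ s) n j k))
    where
    identity : ∀ s n j k → s + (j + k) + n * j + 0 * suc n ≡ s + k + j * suc n
    identity = solve-∀

  bwd≡fwd : ∀ c t k → t + k ≡ N → bwd c t ≡ fwd c k
  bwd≡fwd c t k t+k≡N =
    mod-congruent _ _ k n (trans (identity (toℕ c) n t k) (cong (λ m → toℕ c + k + n * m) t+k≡N))
    where
    identity : ∀ c n t k → c + n * t + k * suc n ≡ c + k + n * (t + k)
    identity = solve-∀

  offset : ∀ c d → Σ ℕ λ k → k < N × fwd c k ≡ d
  offset c d = r % N , m%n<n r N , trans (mod-congruent _ _ (r / N) (toℕ c) eq) (mod-toℕ d)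
    where
    r : ℕ
    r = toℕ d + n * toℕ c
    identity : ∀ c d n → c + (d + n * c) ≡ d + c * suc n
    identity = solve-∀
    eq : toℕ c + r % N + r / N * N ≡ toℕ d + toℕ c * N
    eq = begin
      toℕ c + r % N + r / N * N    ≡⟨ +-assoc (toℕ c) _ _ ⟩
      toℕ c + (r % N + r / N * N)  ≡⟨ cong (toℕ c +_) (m≡m%n+[m/n]*n r N) ⟨
      toℕ c + r                    ≡⟨ identity (toℕ c) (toℕ d) n ⟩
      toℕ d + toℕ c * N            ∎
      where open ≡-Reasoning

  F : ℕ → ℕ
  F x = lab (x mod N)

  unroll : ℕ → Fin N → ℕ
  unroll q s = toℕ s + q * N

  F-unroll : ∀ q s k → F (unroll q s + k) ≡ lab (fwd s k)
  F-unroll q s k = cong lab (mod-congruent _ _ 0 q (identity (toℕ s) q k n))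
    where
    identity : ∀ s q k n → s + q * suc n + k + 0 * suc n ≡ s + k + q * suc n
    identity = solve-∀

  F-unroll₀ : ∀ q s → F (unroll q s) ≡ lab s
  F-unroll₀ q s =
    trans (cong F (sym (+-identityʳ (unroll q s)))) (trans (F-unroll q s 0) (cong lab (fwd-0 s)))

  unroll-meet : ∀ s k s′ k′ → fwd s k ≡ fwd s′ k′ →
                Σ ℕ λ q → Σ ℕ λ q′ → unroll q s + k ≡ unroll q′ s′ + k′
  unroll-meet s k s′ k′ eq = y / N , x / N , (begin
      toℕ s + y / N * N + k          ≡⟨ xy∙z≈xz∙y (toℕ s) (y / N * N) k ⟩
      x + y / N * N                  ≡⟨ cong (_+ y / N * N) (m≡m%n+[m/n]*n x N) ⟩
      x % N + x / N * N + y / N * N  ≡⟨ cong (λ r → r + x / N * N + y / N * N) same-residue ⟩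
      y % N + x / N * N + y / N * N  ≡⟨ xy∙z≈xz∙y (y % N) (x / N * N) (y / N * N) ⟩
      y % N + y / N * N + x / N * N  ≡⟨ cong (_+ x / N * N) (m≡m%n+[m/n]*n y N) ⟨
      y + x / N * N                  ≡⟨ xy∙z≈xz∙y (toℕ s′) (x / N * N) k′ ⟨
      toℕ s′ + x / N * N + k′        ∎)
    where
    open ≡-Reasoning
    x y : ℕ
    x = toℕ s + k
    y = toℕ s′ + k′
    same-residue : x % N ≡ y % N
    same-residue = trans (sym (toℕ-mod x)) (trans (cong toℕ eq) (toℕ-mod y))

  module Lin = Linear F

  unroll-arc : ℕ → Arc → ℕ × ℕ
  unroll-arc q ((s , L) , _) = unroll q s , unroll q s + (L ∸ 1)

  unroll-isArc : ∀ q A → Lin.IsArc (unroll-arc q A)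
  unroll-isArc q ((s , L) , s≤s (s≤s _) , _ , arc) = m<m+n _ z<s , inner
    where
    p : ℕ
    p = unroll q s
    inner : ∀ {x} → p < x → x < p + (L ∸ 1) → F p < F x × F (p + (L ∸ 1)) < F x
    inner {x} p<x x<end =
      subst₂ _<_ (sym (F-unroll₀ q s)) F-x (proj₁ (arc k 0<k k+1<L)) ,
      subst₂ _<_ (sym (F-unroll q s (L ∸ 1))) F-x (proj₂ (arc k 0<k k+1<L))
      where
      k : ℕ
      k = x ∸ p
      p+k≡x : p + k ≡ x
      p+k≡x = m+[n∸m]≡n (<⇒≤ p<x)
      0<k : 0 < k
      0<k = m<n⇒0<n∸m p<x
      k+1<L : suc k < L
      k+1<L = s≤s (+-cancelˡ-< p k (L ∸ 1) (subst (_< p + (L ∸ 1)) (sym p+k≡x) x<end))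
      F-x : lab (fwd s k) ≡ F x
      F-x = trans (sym (F-unroll q s k)) (cong F p+k≡x)

  unroll-level : ∀ q A → Lin.level (unroll-arc q A) ≡ level A
  unroll-level q ((s , L) , _) = cong₂ _⊔_ (F-unroll₀ q s) (F-unroll q s (L ∸ 1))

  unroll-injective : ∀ q q′ A B → unroll-arc q A ≡ unroll-arc q′ B → interval A ≡ interval B
  unroll-injective q q′ ((s , L) , s≤s (s≤s _) , _) ((s′ , L′) , s≤s (s≤s _) , _) eq =
    cong₂ _,_ (trans (sym (mod-toℕ s)) (trans (mod-congruent _ _ q q′ starts) (mod-toℕ s′)))
              (cong suc (+-cancelˡ-≡ (unroll q s) _ _ ends))
    where
    starts : unroll q s ≡ unroll q′ s′
    starts = cong proj₁ eq
    ends : unroll q s + (L ∸ 1) ≡ unroll q s + (L′ ∸ 1)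
    ends = trans (cong proj₂ eq) (cong (_+ (L′ ∸ 1)) (sym starts))

  unroll-∈ : ∀ q s {k L} → k < L → Lin.Between (unroll q s , unroll q s + (L ∸ 1)) (unroll q s + k)
  unroll-∈ q s {L = suc L} (s≤s k≤L) = m≤m+n _ _ , +-monoʳ-≤ (unroll q s) k≤L

  unroll-internal : ∀ q s {k L} → 0 < k → suc k < L →
                    Lin.StrictlyBetween (unroll q s , unroll q s + (L ∸ 1)) (unroll q s + k)
  unroll-internal q s {L = suc L} 0<k (s≤s k<L) = m<m+n _ 0<k , +-monoʳ-< (unroll q s) k<L

  Nested : Arc → Arc → Set
  Nested A B = A ⊆A B × level B < level A

  unroll-nested : ∀ q q′ A B → Lin.Nested (unroll-arc q A) (unroll-arc q′ B) → Nested A B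
  unroll-nested q q′ A@((s , L) , s≤s (s≤s _) , _) B@((s′ , L′) , s≤s (s≤s _) , _) ((p′≤p , ends) , lt) =
    (d , subst (_≤ L′) (sym (+-suc d (L ∸ 1))) (s≤s (+-cancelˡ-≤ p′ _ _ end-bound)) , start) ,
    subst₂ _<_ (unroll-level q′ B) (unroll-level q A) lt
    where
    p p′ d : ℕ
    p = unroll q s
    p′ = unroll q′ s′
    d = p ∸ p′
    p′+d≡p : p′ + d ≡ p
    p′+d≡p = m+[n∸m]≡n p′≤p
    end-bound : p′ + (d + (L ∸ 1)) ≤ p′ + (L′ ∸ 1)
    end-bound =
      subst (_≤ p′ + (L′ ∸ 1)) (trans (cong (_+ (L ∸ 1)) (sym p′+d≡p)) (+-assoc p′ d (L ∸ 1))) ends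
    start : fwd s′ d ≡ s
    start =
      trans (mod-congruent _ _ q′ q (trans (xy∙z≈xz∙y (toℕ s′) d (q′ * N)) p′+d≡p)) (mod-toℕ s)

  nested-at : ∀ A B → interval A ≢ interval B → ∀ {ka kb} →
              let (sa , La) = interval A ; (sb , Lb) = interval B in
              fwd sa ka ≡ fwd sb kb → ka < La → kb < Lb →
              (0 < ka × suc ka < La) ⊎ (0 < kb × suc kb < Lb) → Nested A B ⊎ Nested B A
  nested-at A@((sa , La) , _) B@((sb , Lb) , _) A≢B {ka} {kb} same ka<La kb<Lb inner
    with unroll-meet sa ka sb kb same
  ... | qa , qb , meet =
    Sum.map (unroll-nested qa qb A B) (unroll-nested qb qa B A)
      (Lin.nested (unroll-isArc qa A) (unroll-isArc qb B) (A≢B ∘ unroll-injective qa qb A B)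
        (unroll-∈ qa sa ka<La) (at-meet Lin.Between (unroll-∈ qb sb kb<Lb))
        (Sum.map (λ (0<ka , ka+1<La) → unroll-internal qa sa 0<ka ka+1<La)
                 (λ (0<kb , kb+1<Lb) → at-meet Lin.StrictlyBetween (unroll-internal qb sb 0<kb kb+1<Lb))
                 inner))
    where
    at-meet : (P : ℕ × ℕ → ℕ → Set) →
              P (unroll-arc qb B) (unroll qb sb + kb) → P (unroll-arc qb B) (unroll qa sa + ka)
    at-meet P = subst (P (unroll-arc qb B)) (sym meet)

  nested : (A B : Arc) → interval A ≢ interval B →
           (Σ (Fin N) λ c → (Internal c (interval A) ⊎ Internal c (interval B)) × c ∈A A × c ∈A B) →
           Nested A B ⊎ Nested B A
  nested A B A≢B (c , inj₁ (ka , 0<ka , ka+1<La , ea) , _ , kb , kb<Lb , eb) =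
    nested-at A B A≢B (trans ea (sym eb)) (<-trans (n<1+n ka) ka+1<La) kb<Lb (inj₁ (0<ka , ka+1<La))
  nested A B A≢B (c , inj₂ (kb , 0<kb , kb+1<Lb , eb) , (ka , ka<La , ea) , _) =
    nested-at A B A≢B (trans ea (sym eb)) ka<La (<-trans (n<1+n kb) kb+1<Lb) (inj₂ (0<kb , kb+1<Lb))

  interval-≟ : (I J : Interval) → Dec (I ≡ J)
  interval-≟ = ≡-dec Fin._≟_ ℕ._≟_

  intervalLevel : Interval → ℕ
  intervalLevel (s , L) = lab s ⊔ lab (fwd s (L ∸ 1))

  internal⇒∈ : ∀ {c I} → Internal c I → c ∈I I
  internal⇒∈ (k , _ , k+1<L , eq) = k , <-trans (n<1+n k) k+1<L , eq

  ⊆I-∈I : ∀ {c I J} → I ⊆I J → c ∈I I → c ∈I J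
  ⊆I-∈I {J = s′ , _} (d , d+L≤L′ , refl) (k , k<L , refl) =
    d + k , <-≤-trans (+-monoʳ-< d k<L) d+L≤L′ , sym (fwd-fwd s′ d k)

  level<internal : ∀ {c} (A : Arc) → Internal c (interval A) → level A < lab c
  level<internal ((s , L) , _ , _ , arc) (k , 0<k , k+1<L , refl) =
    ⊔-pres-<m (proj₁ (arc k 0<k k+1<L)) (proj₂ (arc k 0<k k+1<L))

  internal-or-extremity : ∀ {c} (A : Arc) → c ∈A A → Internal c (interval A) ⊎ lab c ≤ level A
  internal-or-extremity ((s , L) , _) (zero , _ , refl) =
    inj₂ (≤-trans (≤-reflexive (cong lab (fwd-0 s))) (m≤m⊔n _ _))
  internal-or-extremity ((s , L) , _) (suc k , k<L , refl) with m≤n⇒m<n∨m≡n k<L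
  ... | inj₁ k+1<L = inj₁ (suc k , z<s , k+1<L , refl)
  ... | inj₂ refl = inj₂ (m≤n⊔m _ _)

  level-attained : (A : Arc) → Σ (Fin N) λ c → c ∈A A × lab c ≡ level A
  level-attained ((s , L) , s≤s (s≤s _) , _) with ⊔-sel (lab s) (lab (fwd s (L ∸ 1)))
  ... | inj₁ eq = s , (0 , z<s , fwd-0 s) , sym eq
  ... | inj₂ eq = fwd s (L ∸ 1) , (L ∸ 1 , n<1+n _ , refl) , sym eq

  ⊆-lower-level : (A B : Arc) {c : Fin N} → c ∈A A → Internal c (interval B) → level B < level A →
                  A ⊆A B
  ⊆-lower-level A B {c} c∈A c∈°B B<A with interval-≟ (interval A) (interval B)
  ... | yes eq = ⊥-elim (<-irrefl (cong intervalLevel (sym eq)) B<A)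
  ... | no A≢B with nested A B A≢B (c , inj₂ c∈°B , c∈A , internal⇒∈ {I = interval B} c∈°B)
  ...   | inj₁ (A⊆B , _) = A⊆B
  ...   | inj₂ (_ , A<B) = ⊥-elim (<-asym A<B B<A)

  same-level-unique : (A B : Arc) {c : Fin N} → c ∈A A → Internal c (interval B) → level A ≡ level B →
                      interval A ≡ interval B
  same-level-unique A B {c} c∈A c∈°B A≡B with interval-≟ (interval A) (interval B)
  ... | yes eq = eq
  ... | no A≢B with nested A B A≢B (c , inj₂ c∈°B , c∈A , internal⇒∈ {I = interval B} c∈°B)
  ...   | inj₁ (_ , B<A) = ⊥-elim (<-irrefl (sym A≡B) B<A)
  ...   | inj₂ (_ , A<B) = ⊥-elim (<-irrefl A≡B A<B)

  record Window (c : Fin N) : Set where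
    field
      back ahead : ℕ
      prev : FirstBelow (λ j → lab (bwd c j)) (lab c) back
      next : FirstBelow (λ j → lab (fwd c j)) (lab c) ahead
      fits : back + ahead ≤ N

  -- The next smaller corner comes no later than m; walking backwards, the next smaller corner is
  -- reached after N ∸ ahead steps, so the previous smaller corner comes no later than that.
  window : ∀ {c} m → lab m < lab c → Window c
  window {c} m m<c with offset c m
  ... | k , k<N , refl
    with first-below (λ j → lab (fwd c j)) (≤-reflexive (cong lab (sym (fwd-0 c)))) m<c
  ... | ahead , ahead≤k , next
    with first-below (λ j → lab (bwd c j)) (≤-reflexive (cong lab (sym (bwd-0 c)))) wrapped
    where
    t+ahead≡N : N ∸ ahead + ahead ≡ N
    t+ahead≡N = m∸n+n≡m (<⇒≤ (≤-<-trans ahead≤k k<N))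
    wrapped : lab (bwd c (N ∸ ahead)) < lab c
    wrapped = subst (λ d → lab d < lab c) (sym (bwd≡fwd c (N ∸ ahead) ahead t+ahead≡N))
                    (FirstBelow.drops next)
  ... | back , back≤t , prev = record
    { back = back ; ahead = ahead ; prev = prev ; next = next
    ; fits = subst (back + ahead ≤_) (m∸n+n≡m (<⇒≤ (≤-<-trans ahead≤k k<N)))
                   (+-monoˡ-≤ ahead back≤t) }

  window-of : (Σ (Fin N) λ m → lab m ≡ 1) → ∀ {c} → 2 ≤ lab c → Window c
  window-of (m , m-label) {c} 2≤c = window m (subst (_< lab c) (sym m-label) 2≤c)

  module WindowArc {c : Fin N} (w : Window c) where
    open Window w public
    module Prev = FirstBelow prev
    module Next = FirstBelow next

    start : Fin N
    start = bwd c back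

    at-back : fwd start back ≡ c
    at-back = trans (cong (fwd start) (sym (+-identityʳ back))) (trans (fwd-bwd-past c back 0) (fwd-0 c))

    at-end : fwd start (back + ahead) ≡ fwd c ahead
    at-end = fwd-bwd-past c back ahead

    inside : ∀ k → 0 < k → k < back + ahead → lab c ≤ lab (fwd start k)
    inside k 0<k k<end with <-cmp k back
    ... | tri< k<back _ _ =
      subst (λ d → lab c ≤ lab d) (sym corner)
        (Prev.before (back ∸ k) (m<n⇒0<n∸m k<back) (∸-monoʳ-< 0<k (<⇒≤ k<back)))
      where
      corner : fwd start k ≡ bwd c (back ∸ k)
      corner = subst (λ b → fwd (bwd c b) k ≡ bwd c (back ∸ k)) (m∸n+n≡m (<⇒≤ k<back))
                     (fwd-bwd c (back ∸ k) k)
    ... | tri≈ _ refl _ = ≤-reflexive (cong lab (sym at-back))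
    ... | tri> _ _ back<k =
      subst (λ d → lab c ≤ lab d) (sym corner)
        (Next.before (k ∸ back) (m<n⇒0<n∸m back<k)
          (+-cancelˡ-< back _ _ (subst (_< back + ahead) (sym back+j≡k) k<end)))
      where
      back+j≡k : back + (k ∸ back) ≡ k
      back+j≡k = m+[n∸m]≡n (<⇒≤ back<k)
      corner : fwd start k ≡ fwd c (k ∸ back)
      corner = subst (λ b → fwd start b ≡ fwd c (k ∸ back)) back+j≡k (fwd-bwd-past c back (k ∸ back))

    arc : Arc
    arc = (start , suc (back + ahead)) ,
          s≤s (≤-trans Prev.positive (m≤m+n back ahead)) , s≤s fits ,
          λ k 0<k k+1<L → let k<end = s≤s⁻¹ k+1<L in
            <-≤-trans Prev.drops (inside k 0<k k<end) ,
            <-≤-trans (subst (λ d → lab d < lab c) (sym at-end) Next.drops) (inside k 0<k k<end)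

    c-internal : Internal c (interval arc)
    c-internal = back , Prev.positive , s≤s (m<m+n back Next.positive) , at-back

    nontrivial : NonTrivial arc
    nontrivial = s≤s (+-mono-≤ Prev.positive Next.positive)

    internal-label : ∀ {d} → Internal d (interval arc) → lab c ≤ lab d
    internal-label (k , 0<k , k+1<L , refl) = inside k 0<k (s≤s⁻¹ k+1<L)

    arc-level : level arc ≡ lab start ⊔ lab (fwd c ahead)
    arc-level = cong (λ d → lab start ⊔ lab d) at-end

    -- (a) puts a corner of label level + 1 in the window; it cannot be an extremity, and internal
    -- corners have label at least lab c, which exceeds the level.
    arc-level≡pred : (∀ d → 1 ≤ lab d) → PropA → level arc ≡ lab c ∸ 1
    arc-level≡pred positive PA
      with PA (level arc) (≤-trans (positive start) (m≤m⊔n _ _)) arc refl nontrivial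
    ... | d , d∈arc , d-label with internal-or-extremity arc d∈arc
    ...   | inj₂ d≤level = ⊥-elim (<-irrefl refl (subst (_≤ level arc) d-label d≤level))
    ...   | inj₁ d∈°arc = cong (_∸ 1) (≤-antisym (level<internal arc c-internal)
                                                  (subst (lab c ≤_) d-label (internal-label d∈°arc)))

  A⇒C : (∀ d → 1 ≤ lab d) → (Σ (Fin N) λ m → lab m ≡ 1) → PropA → PropC
  A⇒C positive one PA _ 2≤i c refl = [ by-prev , by-next ]′ (⊔-sel (lab start) (lab (fwd c ahead)))
    where
    open WindowArc (window-of one 2≤i)
    pred-level : lab start ⊔ lab (fwd c ahead) ≡ lab c ∸ 1
    pred-level = trans (sym arc-level) (arc-level≡pred positive PA)
    by-prev : lab start ⊔ lab (fwd c ahead) ≡ lab start → NextSmallerIsPred c ⊎ PrevSmallerIsPred c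
    by-prev eq = inj₂ (back , Prev.positive , trans (sym eq) pred-level , Prev.before)
    by-next : lab start ⊔ lab (fwd c ahead) ≡ lab (fwd c ahead) → NextSmallerIsPred c ⊎ PrevSmallerIsPred c
    by-next eq = inj₁ (ahead , Next.positive , trans (sym eq) pred-level , Next.before)

  InternalLabel : Arc → ℕ → Set
  InternalLabel A x = Σ (Fin N) λ c → Internal c (interval A) × lab c ≡ x

  B⇒A : PropB → PropA
  B⇒A PB i 1≤i A@((s , L) , _) level≡i nontrivial with PB i 1≤i A level≡i nontrivial
  ... | m , spectrum with proj₁ (spectrum _) (fwd s 1 , (1 , z<s , nontrivial , refl) , refl)
  ...   | i<x , x≤m with proj₂ (spectrum (suc i)) ≤-refl (≤-trans i<x x≤m)
  ...     | c , c∈°A , c-label = c , internal⇒∈ {I = interval A} c∈°A , c-label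

  walk-forward : ∀ {s e p k y} → p < e → lab (fwd s e) < y →
                 (∀ j → 0 < j → j ≤ k → y ≤ lab (fwd s (p + j))) → p + k < e
  walk-forward {s} {e} {p} {k} {y} p<e end<y above with p + k <? e
  ... | yes p+k<e = p+k<e
  ... | no p+k≮e =
    ⊥-elim (<⇒≱ end<y (subst (λ t → y ≤ lab (fwd s t)) (m+[n∸m]≡n (<⇒≤ p<e)) end-above))
    where
    end-above : y ≤ lab (fwd s (p + (e ∸ p)))
    end-above =
      above (e ∸ p) (m<n⇒0<n∸m p<e) (subst (e ∸ p ≤_) (m+n∸m≡n p k) (∸-monoˡ-≤ p (≮⇒≥ p+k≮e)))

  walk-backward : ∀ {s p k y} → 0 < p → lab s < y →
                  (∀ j → 0 < j → j ≤ k → y ≤ lab (bwd (fwd s p) j)) → k < p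
  walk-backward {s} {p} {k} {y} 0<p start<y above with k <? p
  ... | yes k<p = k<p
  ... | no k≮p = ⊥-elim (<⇒≱ start<y (subst (λ d → y ≤ lab d) at-start (above p 0<p (≮⇒≥ k≮p))))
    where
    at-start : bwd (fwd s p) p ≡ s
    at-start = trans (cong (λ t → bwd (fwd s t) p) (sym (+-identityʳ p))) (trans (bwd-fwd s p 0) (fwd-0 s))

  -- (c) at an internal corner of label y + 1 yields a corner of label y reached without crossing a
  -- label below y; as y exceeds the level, that walk cannot reach an extremity of the arc.
  internal-step : PropC → (A : Arc) → ∀ {y} → level A < y → InternalLabel A (suc y) → InternalLabel A y
  internal-step PC A@((s , L) , s≤s (s≤s _) , _) {y} level<y (c , (p , 0<p , p+1<L , refl) , c-label)
    with PC (suc y) (s≤s (≤-trans z<s level<y)) (fwd s p) c-label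
  ... | inj₁ (k , _ , drop , before) =
    fwd s (p + k) ,
    (p + k , ≤-trans 0<p (m≤m+n p k) , s≤s (walk-forward {s} (s≤s⁻¹ p+1<L) end<y along) , refl) ,
    trans (cong lab (sym (fwd-fwd s p k))) (trans drop pred-label)
    where
    pred-label : lab (fwd s p) ∸ 1 ≡ y
    pred-label = cong (_∸ 1) c-label
    end<y : lab (fwd s (L ∸ 1)) < y
    end<y = ≤-<-trans (m≤n⊔m _ _) level<y
    along : ∀ j → 0 < j → j ≤ k → y ≤ lab (fwd s (p + j))
    along j 0<j j≤k =
      subst₂ _≤_ pred-label (cong lab (fwd-fwd s p j)) (pred≤-up-to-drop drop before j 0<j j≤k)
  ... | inj₂ (k , _ , drop , before) =
    fwd s (p ∸ k) ,
    (p ∸ k , m<n⇒0<n∸m k<p , ≤-<-trans (s≤s (m∸n≤m p k)) p+1<L , refl) ,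
    trans (cong lab (sym back-at)) (trans drop pred-label)
    where
    pred-label : lab (fwd s p) ∸ 1 ≡ y
    pred-label = cong (_∸ 1) c-label
    along : ∀ j → 0 < j → j ≤ k → y ≤ lab (bwd (fwd s p) j)
    along j 0<j j≤k = subst (_≤ _) pred-label (pred≤-up-to-drop drop before j 0<j j≤k)
    k<p : k < p
    k<p = walk-backward {s} 0<p (≤-<-trans (m≤m⊔n _ _) level<y) along
    back-at : bwd (fwd s p) k ≡ fwd s (p ∸ k)
    back-at =
      subst (λ t → bwd (fwd s t) k ≡ fwd s (p ∸ k)) (m+[n∸m]≡n (<⇒≤ k<p)) (bwd-fwd s k (p ∸ k))

  C⇒B : PropC → PropB
  C⇒B PC i _ A@((s , L) , _) level≡i (s≤s (s≤s (s≤s {n = K} _))) = top , λ x → bounded x , attained x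
    where
    g : ℕ → ℕ
    g k = lab (fwd s k)
    top : ℕ
    top = maxOver g (suc K)
    bounded : ∀ x → InternalLabel A x → suc i ≤ x × x ≤ top
    bounded _ (c , c∈°A@(k , 0<k , k+1<L , refl) , refl) =
      subst (_< lab c) level≡i (level<internal A c∈°A) , ≤-maxOver g 0<k (s≤s⁻¹ (s≤s⁻¹ k+1<L))
    top-attained : InternalLabel A top
    top-attained with maxOver-attained g (suc K) z<s
    ... | k , 0<k , k≤K , gk = fwd s k , (k , 0<k , s≤s (s≤s k≤K) , refl) , gk
    descend : ∀ d {x} → suc i ≤ x → x + d ≡ top → InternalLabel A x
    descend zero {x} _ x+0≡top = subst (InternalLabel A) (trans (sym x+0≡top) (+-identityʳ x)) top-attained
    descend (suc d) {x} i<x x+d+1≡top =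
      internal-step PC A (subst (_< x) (sym level≡i) i<x)
        (descend d (m≤n⇒m≤1+n i<x) (trans (sym (+-suc x d)) x+d+1≡top))
    attained : ∀ x → suc i ≤ x → x ≤ top → InternalLabel A x
    attained x i<x x≤top = descend (top ∸ x) i<x (m+[n∸m]≡n x≤top)

  corner-arc : (∀ d → 1 ≤ lab d) → (Σ (Fin N) λ m → lab m ≡ 1) → PropA →
               ∀ i → 2 ≤ i → (c : Fin N) → lab c ≡ i →
               Σ Arc λ B → level B ≡ i ∸ 1 × c ∈A B × NonTrivial B ×
                 ((B′ : Arc) → level B′ ≡ i ∸ 1 → c ∈A B′ → interval B′ ≡ interval B)
  corner-arc positive one PA _ 2≤i c refl =
    arc , arc-level≡pred positive PA , internal⇒∈ {I = interval arc} c-internal , nontrivial ,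
    λ B′ B′-level c∈B′ →
      same-level-unique B′ arc c∈B′ c-internal (trans B′-level (sym (arc-level≡pred positive PA)))
    where open WindowArc (window-of one 2≤i)

  -- The arc around A is the window of an extremity of A carrying the level of A.
  arc-arc : (∀ d → 1 ≤ lab d) → (Σ (Fin N) λ m → lab m ≡ 1) → PropA →
            ∀ i → 2 ≤ i → (A : Arc) → level A ≡ i →
            Σ Arc λ B → level B ≡ i ∸ 1 × A ⊆A B × NonTrivial B ×
              ((B′ : Arc) → level B′ ≡ i ∸ 1 → A ⊆A B′ → interval B′ ≡ interval B)
  arc-arc positive one PA i 2≤i A level≡i with level-attained A
  ... | e , e∈A , e-label =
    arc , trans (arc-level≡pred positive PA) (cong (_∸ 1) e≡i) ,
    ⊆-lower-level A arc e∈A c-internal (subst (level arc <_) e-label (level<internal arc c-internal)) ,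
    nontrivial ,
    λ B′ B′-level A⊆B′ →
      same-level-unique B′ arc (⊆I-∈I {J = interval B′} A⊆B′ e∈A) c-internal
        (trans B′-level (trans (cong (_∸ 1) (sym e≡i)) (sym (arc-level≡pred positive PA))))
    where
    e≡i : lab e ≡ i
    e≡i = trans e-label level≡i
    open WindowArc (window-of one (subst (2 ≤_) (sym e≡i) 2≤i))

lemma1 : (M : LabeledWhiteCorners) →
    let open LabeledWhiteCorners M using (n)
        open Corners n (cornerLabel M)
    in
    -- (i)
    ((A B : Arc) → interval A ≢ interval B → NonTrivial A → NonTrivial B →
      (Σ (Fin (suc n)) λ c → (Internal c (interval A) ⊎ Internal c (interval B)) × c ∈A A × c ∈A B) →
      (A ⊆A B × level B < level A) ⊎ (B ⊆A A × level A < level B))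
    ×
    -- (ii)
    ((PropA ⇔ PropB) × (PropB ⇔ PropC))
    ×
    -- (iii)
    (PropA →
      ((i : ℕ) → 2 ≤ i → (A : Arc) → level A ≡ i →
        Σ Arc λ B → level B ≡ i ∸ 1 × A ⊆A B × NonTrivial B ×
          ((B' : Arc) → level B' ≡ i ∸ 1 → A ⊆A B' → interval B' ≡ interval B))
      ×
      ((i : ℕ) → 2 ≤ i → (c : Fin (suc n)) → cornerLabel M c ≡ i →
        Σ Arc λ B → level B ≡ i ∸ 1 × c ∈A B × NonTrivial B ×
          ((B' : Arc) → level B' ≡ i ∸ 1 → c ∈A B' → interval B' ≡ interval B)))
lemma1 M =
  (λ A B A≢B _ _ → nested A B A≢B) ,
  (mk⇔ (C⇒B ∘ A⇒C positive one) B⇒A , mk⇔ (A⇒C positive one ∘ B⇒A) C⇒B) ,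
  (λ PA → arc-arc positive one PA , corner-arc positive one PA)
  where
  open LabeledWhiteCorners M
  open Cyclic (cornerLabel M)
  positive : ∀ c → 1 ≤ cornerLabel M c
  positive c = lbl-pos (vertex c)
  one : Σ (Fin (suc n)) λ c → cornerLabel M c ≡ 1
  one with lbl-min
  ... | v , v-label with vertex-surj v
  ...   | c , vertex≡v = c , trans (cong lbl (vertex≡v refl)) v-label
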